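{- Let $D=(A,B,\lambda)$ be a temporal bi-clique with $A,B$ nonempty and $\lambda$ injective. If $|A|\ne|B|$, then $D$ has a dismountable vertex.
   Context: A temporal bi-clique $(A,B,\lambda)$ is the complete bipartite graph with disjoint parts $A,B$ with an edge labeling $\lambda$ into $\mathbb{N}$. For a vertex $v$, $\pi^-(v)$ is the neighbor $u$ of $v$ minimizing $\lambda(\{v,u\})$ and $\pi^+(v)$ the neighbor maximizing it. A vertex $a\in A$ is dismountable if there is $a'\in A$, $a'\ne a$, with $\lambda(\{a,\pi^-(a')\})\le\lambda(\{a',\pi^-(a')\})$. A vertex $b\in B$ is dismountable if there is $b'\in B$, $b'\ne b$, with $\lambda(\{b',\pi^+(b')\})\le\lambda(\{b,\pi^+(b')\})$. -}

module Defs where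

open import Data.Nat using (ℕ; _≤_)
open import Data.Fin using (Fin)
open import Data.Sum using (_⊎_)
open import Data.Product using (_×_; Σ; ∃-syntax)
open import Relation.Binary.PropositionalEquality using (_≡_)
open import Relation.Nullary using (¬_)

-- A temporal bi-clique with parts A = Fin p, B = Fin q; the label of the
-- edge {a,b} (a ∈ A, b ∈ B) is  lab a b.
Labeling : ℕ → ℕ → Set
Labeling p q = Fin p → Fin q → ℕ

InjectiveLabeling : ∀ {p q} → Labeling p q → Set
InjectiveLabeling {p} {q} lab =
  ∀ (a a' : Fin p) (b b' : Fin q) → lab a b ≡ lab a' b' → (a ≡ a') × (b ≡ b')

IsPiMinusA : ∀ {p q} → Labeling p q → Fin p → Fin q → Set
IsPiMinusA {p} {q} lab a b = ∀ (b' : Fin q) → lab a b ≤ lab a b'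

IsPiPlusB : ∀ {p q} → Labeling p q → Fin q → Fin p → Set
IsPiPlusB {p} {q} lab b a = ∀ (a' : Fin p) → lab a' b ≤ lab a b

DismountableA : ∀ {p q} → Labeling p q → Fin p → Set
DismountableA {p} {q} lab a =
  Σ (Fin p) λ a' → ¬ (a' ≡ a) × Σ (Fin q) λ b →
    IsPiMinusA lab a' b × (lab a b ≤ lab a' b)

DismountableB : ∀ {p q} → Labeling p q → Fin q → Set
DismountableB {p} {q} lab b =
  Σ (Fin q) λ b' → ¬ (b' ≡ b) × Σ (Fin p) λ a →
    IsPiPlusB lab b' a × (lab a b' ≤ lab a b)

HasDismountable : ∀ {p q} → Labeling p q → Set
HasDismountable {p} {q} lab =
  (Σ (Fin p) λ a → DismountableA lab a) ⊎ (Σ (Fin q) λ b → DismountableB lab b)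

-- Every vertex of the larger side has a π-neighbour on the smaller side (π⁻ for
-- A, π⁺ for B), so by pigeonhole two distinct vertices of the larger side share
-- it.  Comparing their labels on that shared edge, the one with the smaller
-- label (for A) or the larger label (for B) is dismountable.
module Submission where

open import Defs
open import Data.Nat using (ℕ; suc; zero; _≤_; _<_)
open import Data.Nat.Properties using (≤-total; ≤-trans; ≤-refl; <-cmp)
open import Data.Fin using (Fin) renaming (zero to fz; suc to fs)
open import Data.Fin.Properties using (pigeonhole; <⇒≢)
open import Data.Product using (_,_; ∃; proj₁; proj₂)
open import Data.Sum using (inj₁; inj₂)
open import Relation.Binary using (tri<; tri≈; tri>)
open import Relation.Binary.PropositionalEquality using (_≡_; _≢_; sym; subst)
open import Relation.Nullary using (¬_; contradiction)

minimiser : ∀ n (f : Fin (suc n) → ℕ) → ∃ λ i → ∀ j → f i ≤ f j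
minimiser zero    f = fz , λ { fz → ≤-refl }
minimiser (suc n) f with minimiser n (λ k → f (fs k))
... | i , min with ≤-total (f fz) (f (fs i))
... | inj₁ f0≤ = fz   , λ { fz → ≤-refl ; (fs j) → ≤-trans f0≤ (min j) }
... | inj₂ ≤f0 = fs i , λ { fz → ≤f0    ; (fs j) → min j }

maximiser : ∀ n (f : Fin (suc n) → ℕ) → ∃ λ i → ∀ j → f j ≤ f i
maximiser zero    f = fz , λ { fz → ≤-refl }
maximiser (suc n) f with maximiser n (λ k → f (fs k))
... | i , max with ≤-total (f fz) (f (fs i))
... | inj₂ ≤f0 = fz   , λ { fz → ≤-refl ; (fs j) → ≤-trans (max j) ≤f0 }
... | inj₁ f0≤ = fs i , λ { fz → f0≤    ; (fs j) → max j }

module _ {p q : ℕ} (lab : Labeling p q) where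

  shared-π⁻⇒dismountable : ∀ {a₁ a₂ b} → a₁ ≢ a₂ →
    IsPiMinusA lab a₁ b → IsPiMinusA lab a₂ b → HasDismountable lab
  shared-π⁻⇒dismountable {a₁} {a₂} {b} a₁≢a₂ π₁ π₂ with ≤-total (lab a₁ b) (lab a₂ b)
  ... | inj₁ ≤ = inj₁ (a₁ , a₂ , (λ e → a₁≢a₂ (sym e)) , b , π₂ , ≤)
  ... | inj₂ ≥ = inj₁ (a₂ , a₁ , a₁≢a₂ , b , π₁ , ≥)

  shared-π⁺⇒dismountable : ∀ {b₁ b₂ a} → b₁ ≢ b₂ →
    IsPiPlusB lab b₁ a → IsPiPlusB lab b₂ a → HasDismountable lab
  shared-π⁺⇒dismountable {b₁} {b₂} {a} b₁≢b₂ π₁ π₂ with ≤-total (lab a b₁) (lab a b₂)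
  ... | inj₁ ≤ = inj₂ (b₂ , b₁ , b₁≢b₂ , a , π₁ , ≤)
  ... | inj₂ ≥ = inj₂ (b₁ , b₂ , (λ e → b₁≢b₂ (sym e)) , a , π₂ , ≥)

module _ {m n : ℕ} (lab : Labeling (suc m) (suc n)) where

  π⁻ : Fin (suc m) → Fin (suc n)
  π⁻ a = proj₁ (minimiser n (lab a))

  π⁻-isPiMinus : ∀ a → IsPiMinusA lab a (π⁻ a)
  π⁻-isPiMinus a = proj₂ (minimiser n (lab a))

  π⁺ : Fin (suc n) → Fin (suc m)
  π⁺ b = proj₁ (maximiser m (λ a → lab a b))

  π⁺-isPiPlus : ∀ b → IsPiPlusB lab b (π⁺ b)
  π⁺-isPiPlus b = proj₂ (maximiser m (λ a → lab a b))

  larger-A⇒dismountable : suc n < suc m → HasDismountable lab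
  larger-A⇒dismountable n<m with pigeonhole n<m π⁻
  ... | a₁ , a₂ , a₁<a₂ , π⁻-eq =
    shared-π⁻⇒dismountable lab (<⇒≢ a₁<a₂) (π⁻-isPiMinus a₁)
      (subst (IsPiMinusA lab a₂) (sym π⁻-eq) (π⁻-isPiMinus a₂))

  larger-B⇒dismountable : suc m < suc n → HasDismountable lab
  larger-B⇒dismountable m<n with pigeonhole m<n π⁺
  ... | b₁ , b₂ , b₁<b₂ , π⁺-eq =
    shared-π⁺⇒dismountable lab (<⇒≢ b₁<b₂) (π⁺-isPiPlus b₁)
      (subst (IsPiPlusB lab b₂) (sym π⁺-eq) (π⁺-isPiPlus b₂))

lemma14 : (m n : ℕ) (lab : Labeling (suc m) (suc n)) →
          InjectiveLabeling lab → ¬ (suc m ≡ suc n) → HasDismountable lab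
lemma14 m n lab _ m≢n with <-cmp (suc m) (suc n)
... | tri< m<n _ _ = larger-B⇒dismountable lab m<n
... | tri≈ _ m≡n _ = contradiction m≡n m≢n
... | tri> _ _ n<m = larger-A⇒dismountable lab n<m
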